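{- For all integers $k\ge3$ and $n_1,\ldots,n_k\ge1$, the digraph $Q_{2n_1,\ldots,2n_k}$ is a transitive orientation of the graph $G_{2n_1,\ldots,2n_k}$.
   Context: A transitive orientation of a graph $G$ is a transitive digraph on $V(G)$ obtained by replacing each edge $\{x,y\}$ of $G$ by exactly one of the arcs $(x,y),(y,x)$ (and no other arcs). For a digraph $D$, $D^\star$ is its dual (all arcs reversed). For $n\ge0$, $t_n(p)=p+n$, and $t_n(D)$ (resp. $t_n(G)$) is the copy of $D$ (resp. $G$) with vertices shifted by $n$. Put $s_0=0$, $s_i=n_1+\cdots+n_i$. - $G_{2n}$: graph on $\{0,\ldots,2n-1\}$ with edges $\{2i,2j+1\}$, $0\le i\le j\le n-1$. - $G_{2n_1,\ldots,2n_k}$: graph on $\{0,\ldots,2s_k-1\}$ with edge set $\bigcup_{i=0}^{k-1}E(t_{2s_i}(G_{2n_{i+1}}))\cup\{\{2p-1,2q-1\}:1\le p\le n_1,\ n_1+1\le q\le s_k\}$. - $Q_{2n}$: digraph on $\{0,\ldots,2n-1\}$ with arcs $(2p,2q+1)$, $0\le p\le q\le n-1$. - $Q_{2n_1,\ldots,2n_k}$: digraph on $\{0,\ldots,2s_k-1\}$ with arcs $\bigcup_{i=1}^{k-1}A(t_{2s_i}((Q_{2n_{i+1}})^\star))\cup A(Q_{2n_1})\cup\{(2q-1,2p-1):1\le p\le n_1,\ n_1+1\le q\le s_k\}$. -}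

module Defs where

open import Data.Nat using (ℕ; zero; suc; _+_; _*_; _∸_; _≤_; _<_)
open import Data.List using (List; []; _∷_; length; take)
open import Data.Nat.ListAction using (sum)
open import Data.Product using (Σ; ∃; ∃-syntax; _×_; _,_)
open import Data.Sum using (_⊎_)
open import Relation.Nullary using (¬_)
open import Relation.Binary.PropositionalEquality using (_≡_)

-- Graphs / digraphs on ℕ are given by relations; the vertex sets are the
-- ranges {0,…,2 s_k - 1}, identical for G and Q, so only edges/arcs matter.

-- 0-based access into the list (n_1,…,n_k): nAt ns i = n_{i+1} (0 if out of range).
nAt : List ℕ → ℕ → ℕ
nAt []       _       = 0
nAt (n ∷ ns) zero    = n
nAt (n ∷ ns) (suc i) = nAt ns i

s : List ℕ → ℕ → ℕ
s ns i = sum (take i ns)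

GPair : ℕ → ℕ → ℕ → ℕ → Set
GPair c m x y = ∃[ i ] ∃[ j ] (i ≤ j × j < m × x ≡ c + 2 * i × y ≡ c + (2 * j + 1))

QArcBlock : ℕ → ℕ → ℕ → ℕ → Set
QArcBlock c m x y = ∃[ p ] ∃[ q ] (p ≤ q × q < m × x ≡ c + 2 * p × y ≡ c + (2 * q + 1))

Dual : (ℕ → ℕ → Set) → ℕ → ℕ → Set
Dual A x y = A y x

OddPair : List ℕ → ℕ → ℕ → Set
OddPair ns x y = ∃[ p ] ∃[ q ] (1 ≤ p × p ≤ nAt ns 0 × suc (nAt ns 0) ≤ q × q ≤ s ns (length ns)
                               × x ≡ 2 * p ∸ 1 × y ≡ 2 * q ∸ 1)

GPairs : List ℕ → ℕ → ℕ → Set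
GPairs ns x y =
  (∃[ i ] (i < length ns × GPair (2 * s ns i) (nAt ns i) x y))
  ⊎ OddPair ns x y

GEdge : List ℕ → ℕ → ℕ → Set
GEdge ns x y = GPairs ns x y ⊎ GPairs ns y x

QArc : List ℕ → ℕ → ℕ → Set
QArc ns x y =
  QArcBlock 0 (nAt ns 0) x y
  ⊎ (∃[ i ] (1 ≤ i × i < length ns × Dual (QArcBlock (2 * s ns i) (nAt ns i)) x y))
  ⊎ (∃[ p ] ∃[ q ] (1 ≤ p × p ≤ nAt ns 0 × suc (nAt ns 0) ≤ q × q ≤ s ns (length ns)
                    × x ≡ 2 * q ∸ 1 × y ≡ 2 * p ∸ 1))

IsTransitiveOrientation : (D : ℕ → ℕ → Set) (E : ℕ → ℕ → Set) → Set
IsTransitiveOrientation D E =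
  (∀ x y → E x y → (D x y ⊎ D y x) × ¬ (D x y × D y x))
  × (∀ x y → D x y → E x y)
  × (∀ x y z → D x y → D y z → D x z)

{-# OPTIONS --safe #-}
module Submission where

open import Defs
open import Data.Nat using (ℕ; _≤_; _<_; zero; suc; _+_; _*_; _∸_; z≤n; s≤s)
open import Data.Nat.Properties
open import Data.List using (List; length; []; _∷_)
open import Data.List.Relation.Unary.All using (All)
open import Data.Product using (∃; _×_; _,_; proj₁; proj₂)
open import Data.Sum using (_⊎_; inj₁; inj₂; swap)
open import Data.Empty using (⊥; ⊥-elim)
open import Relation.Nullary using (¬_)
open import Relation.Binary.PropositionalEquality

-- Every vertex of Q is a source or a sink, decided by its parity and by which side of
-- 2n₁ it lies on: low evens and high odds only emit arcs, low odds and high evens only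
-- receive them. Hence Q has no directed path of length two, so it is vacuously
-- transitive and no edge can be oriented both ways; the remaining check is that the
-- arcs of Q and the edges of G are the same pairs.

TwoPathFree : (ℕ → ℕ → Set) → Set
TwoPathFree D = ∀ {x y z} → D x y → D y z → ⊥

twoPathFree⇒transitiveOrientation :
  ∀ {D P : ℕ → ℕ → Set} → TwoPathFree D
  → (∀ {x y} → P x y → D x y ⊎ D y x)
  → (∀ {x y} → D x y → P x y ⊎ P y x)
  → IsTransitiveOrientation D (λ x y → P x y ⊎ P y x)
twoPathFree⇒transitiveOrientation {D} free P⇒D D⇒P =
  orient , (λ _ _ → D⇒P) , (λ _ _ _ d e → ⊥-elim (free d e))
  where
    orient : ∀ x y → _ → (D x y ⊎ D y x) × ¬ (D x y × D y x)
    orient x y (inj₁ p) = P⇒D p , λ (d , e) → free d e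
    orient x y (inj₂ p) = swap (P⇒D p) , λ (d , e) → free d e

Even Odd : ℕ → Set
Even x = ∃ λ a → x ≡ 2 * a
Odd  x = ∃ λ a → x ≡ suc (2 * a)

Source Sink : ℕ → ℕ → Set
Source t x = (Even x × x < t) ⊎ (Odd x × t ≤ x)
Sink   t x = (Odd x × x < t) ⊎ (Even x × t ≤ x)

source⇒¬sink : ∀ {t x} → Source t x → ¬ Sink t x
source⇒¬sink (inj₁ ((a , refl) , _)) (inj₁ ((b , e) , _))     = even≢odd a b e
source⇒¬sink (inj₁ (_ , x<t)) (inj₂ (_ , t≤x))             = <⇒≱ x<t t≤x
source⇒¬sink (inj₂ (_ , t≤x)) (inj₁ (_ , x<t))             = <⇒≱ x<t t≤x
source⇒¬sink (inj₂ ((a , e) , _)) (inj₂ ((b , refl) , _)) = even≢odd b a e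

low-even : ∀ {p n} → p < n → Source (2 * n) (2 * p)
low-even {p} p<n = inj₁ ((p , refl) , *-monoʳ-< 2 p<n)

low-odd : ∀ {q n} → q < n → Sink (2 * n) (suc (2 * q))
low-odd {q} {n} q<n = inj₁ ((q , refl) , subst (_≤ 2 * n) (*-suc 2 q) (*-monoʳ-≤ 2 q<n))

2*q+1≡1+2*q : ∀ q → 2 * q + 1 ≡ suc (2 * q)
2*q+1≡1+2*q q = +-comm (2 * q) 1

2*[1+n]∸1≡1+2*n : ∀ n → 2 * suc n ∸ 1 ≡ suc (2 * n)
2*[1+n]∸1≡1+2*n n = cong (_∸ 1) (*-suc 2 n)

2*c+[2*q+1]≡1+2*[c+q] : ∀ c q → 2 * c + (2 * q + 1) ≡ suc (2 * (c + q))
2*c+[2*q+1]≡1+2*[c+q] c q = begin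
  2 * c + (2 * q + 1)   ≡⟨ cong (2 * c +_) (2*q+1≡1+2*q q) ⟩
  2 * c + suc (2 * q)   ≡⟨ +-suc (2 * c) (2 * q) ⟩
  suc (2 * c + 2 * q)   ≡⟨ cong suc (*-distribˡ-+ 2 c q) ⟨
  suc (2 * (c + q))     ∎
  where open ≡-Reasoning

head≤s : ∀ ns {i} → 1 ≤ i → nAt ns 0 ≤ s ns i
head≤s []       _       = z≤n
head≤s (n ∷ ns) (s≤s _) = m≤m+n n _

QArc⇒source×sink : ∀ ns {x y} → QArc ns x y → Source (2 * nAt ns 0) x × Sink (2 * nAt ns 0) y
QArc⇒source×sink ns (inj₁ (p , q , p≤q , q<n , refl , refl)) =
  low-even (≤-<-trans p≤q q<n) , subst (Sink _) (sym (2*q+1≡1+2*q q)) (low-odd q<n)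
QArc⇒source×sink ns (inj₂ (inj₁ (i , 1≤i , _ , p , q , _ , _ , refl , refl))) =
  inj₂ ((c + q , 2*c+[2*q+1]≡1+2*[c+q] c q) , above _)
  , inj₂ ((c + p , sym (*-distribˡ-+ 2 c p)) , above _)
  where
    c = s ns i
    above : ∀ m → 2 * nAt ns 0 ≤ 2 * c + m
    above m = ≤-trans (*-monoʳ-≤ 2 (head≤s ns 1≤i)) (m≤m+n (2 * c) m)
QArc⇒source×sink ns (inj₂ (inj₂ (suc p , suc q , _ , p<n , s≤s n≤q , _ , refl , refl))) =
  subst (Source _) (sym (2*[1+n]∸1≡1+2*n q)) (inj₂ ((q , refl) , m≤n⇒m≤1+n (*-monoʳ-≤ 2 n≤q)))
  , subst (Sink _) (sym (2*[1+n]∸1≡1+2*n p)) (low-odd p<n)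

QArc-twoPathFree : ∀ ns → TwoPathFree (QArc ns)
QArc-twoPathFree ns d e = source⇒¬sink (proj₁ (QArc⇒source×sink ns e)) (proj₂ (QArc⇒source×sink ns d))

GPairs⇒QArc : ∀ ns {x y} → GPairs ns x y → QArc ns x y ⊎ QArc ns y x
GPairs⇒QArc ns (inj₁ (zero  , _ , g))   = inj₁ (inj₁ g)
GPairs⇒QArc ns (inj₁ (suc i , i<k , g)) = inj₂ (inj₂ (inj₁ (suc i , s≤s z≤n , i<k , g)))
GPairs⇒QArc ns (inj₂ (p , q , 1≤p , p≤n , n<q , q≤s , x≡ , y≡)) =
  inj₂ (inj₂ (inj₂ (p , q , 1≤p , p≤n , n<q , q≤s , y≡ , x≡)))

QArc⇒GPairs : ∀ ns {x y} → 0 < length ns → QArc ns x y → GPairs ns x y ⊎ GPairs ns y x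
QArc⇒GPairs ns 0<k (inj₁ a)                       = inj₁ (inj₁ (0 , 0<k , a))
QArc⇒GPairs ns 0<k (inj₂ (inj₁ (i , _ , i<k , a))) = inj₂ (inj₁ (i , i<k , a))
QArc⇒GPairs ns 0<k (inj₂ (inj₂ (p , q , 1≤p , p≤n , n<q , q≤s , x≡ , y≡))) =
  inj₂ (inj₂ (p , q , 1≤p , p≤n , n<q , q≤s , y≡ , x≡))

mainTheorem3 : (ns : List ℕ) → 3 ≤ length ns → All (1 ≤_) ns
               → IsTransitiveOrientation (QArc ns) (GEdge ns)
mainTheorem3 ns 3≤k _ =
  twoPathFree⇒transitiveOrientation (QArc-twoPathFree ns) (GPairs⇒QArc ns)
    (QArc⇒GPairs ns (≤-trans (s≤s z≤n) 3≤k))
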